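{- In $\mathbf{IPF}^I$, for every formula $F$, variable $x$ and parameter $a$ not occurring in $F$: $Ix[F,x=a],\ \exists!a\vdash Ix[F,\exists!x]$.
   Context: $\mathbf{IPF}$ is a natural deduction system of intuitionist positive free logic: a first-order language without function symbols, terms constants and parameters, primitive predicate $\exists!$ ("exists"), identity; standard intuitionist rules for $\land,\rightarrow,\lor,\leftrightarrow$, $\bot E$ to atomic conclusions; $\forall I$ (infer $\forall xA$ from a deduction of $A^x_a$, discharging $\exists!a$, $a$ fresh), $\forall E$ (from $\forall xA$, $\exists!t$ infer $A^x_t$), $\exists I$ (from $A^x_t$, $\exists!t$ infer $\exists xA$), $\exists E$ (from $\exists xA$ and a deduction of $C$ from $A^x_a,\exists!a$ infer $C$, discharging them, $a$ fresh); $=I$: axiom $t=t$; $=E$: from $t_1=t_2$ and $A^x_{t_1}$ infer $A^x_{t_2}$ ($A$ atomic). $\mathbf{IPF}^I$ adds formulas $Ix[F,G]$ ("the $F$ is $G$", binding $x$) with rules ($a,b$ fresh parameters not occurring in $F,G,C$ or other open assumptions of the subdeduction, $a\neq t$): $II$: from $F^x_t,G^x_t,\exists!t$ and a deduction of $a=t$ from $F^x_a,\exists!a$ (discharged) infer $Ix[F,G]$; $IE^{1p}$: from $Ix[F,G]$, $F^x_t$, $\exists!t$, a deduction of $a=t$ from $F^x_a,\exists!a$ and a deduction of $C$ from $F^x_b,G^x_b,\exists!b$ (all discharged) infer $C$; $IE^{2p}$: from $Ix[F,\exists!x],\exists!t_1,\exists!t_2,F^x_{t_1},F^x_{t_2},A^x_{t_1}$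 infer $A^x_{t_2}$ ($A$ atomic); $IE^{3p}$: from $Ix[F,\exists!x]$ and a deduction of $C$ from $F^x_a,\exists!a$ (discharged) infer $C$; $IE^{4p}$: from $Ix[F,x=t_2],\exists!t_1,\exists!t_2,F^x_{t_1},A^x_{t_1}$ infer $A^x_{t_2}$ ($A$ atomic); $IE^{5p}$: from $Ix[F,x=t],\exists!t$ and a deduction of $C$ from $F^x_a,\exists!a$ (discharged) infer $C$. -}

module Defs where

open import Data.Nat using (ℕ; _≡ᵇ_)
open import Data.Bool using (Bool; true; false; if_then_else_; _∨_)
open import Data.List using (List; []; _∷_)
open import Data.List.Membership.Propositional using (_∈_)
open import Data.List.Relation.Unary.All using (All)
open import Relation.Binary.PropositionalEquality using (_≡_; _≢_)

-- Syntax of IPF^I.  No function symbols: closed terms are constants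
-- and parameters; (open) terms additionally include bound variables.

data CTerm : Set where
  par : ℕ → CTerm
  con : ℕ → CTerm

data Term : Set where
  var : ℕ → Term
  ct  : CTerm → Term

infixr 6 _∧'_
infixr 5 _∨'_
infixr 4 _⇒_ _⇔_
infix  7 _≐_

data Formula : Set where
  pred : ℕ → List Term → Formula
  E!   : Term → Formula
  _≐_  : Term → Term → Formula
  ⊥'   : Formula
  _∧'_ _∨'_ _⇒_ _⇔_ : Formula → Formula → Formula
  ∀' ∃' : ℕ → Formula → Formula
  I    : ℕ → Formula → Formula → Formula   -- I x [F , G]  (x bound in F and G)

data Atomic : Formula → Set where
  at-pred : ∀ n ts → Atomic (pred n ts)
  at-E!   : ∀ t → Atomic (E! t)
  at-≐    : ∀ t u → Atomic (t ≐ u)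

-- Substitution A^x_t of a closed term t for the free occurrences of
-- variable x (no capture is possible since t is closed).

substT : ℕ → CTerm → Term → Term
substT x t (var y) = if x ≡ᵇ y then ct t else var y
substT x t (ct c)  = ct c

substTs : ℕ → CTerm → List Term → List Term
substTs x t []       = []
substTs x t (u ∷ us) = substT x t u ∷ substTs x t us

_[_≔_] : Formula → ℕ → CTerm → Formula
pred n ts [ x ≔ t ] = pred n (substTs x t ts)
E! u      [ x ≔ t ] = E! (substT x t u)
(u ≐ v)   [ x ≔ t ] = substT x t u ≐ substT x t v
⊥'        [ x ≔ t ] = ⊥'
(A ∧' B)  [ x ≔ t ] = (A [ x ≔ t ]) ∧' (B [ x ≔ t ])
(A ∨' B)  [ x ≔ t ] = (A [ x ≔ t ]) ∨' (B [ x ≔ t ])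
(A ⇒ B)   [ x ≔ t ] = (A [ x ≔ t ]) ⇒ (B [ x ≔ t ])
(A ⇔ B)   [ x ≔ t ] = (A [ x ≔ t ]) ⇔ (B [ x ≔ t ])
∀' y A    [ x ≔ t ] = if x ≡ᵇ y then ∀' y A else ∀' y (A [ x ≔ t ])
∃' y A    [ x ≔ t ] = if x ≡ᵇ y then ∃' y A else ∃' y (A [ x ≔ t ])
I y F G   [ x ≔ t ] = if x ≡ᵇ y then I y F G else I y (F [ x ≔ t ]) (G [ x ≔ t ])

occC : ℕ → CTerm → Bool
occC a (par b) = a ≡ᵇ b
occC a (con c) = false

occT : ℕ → Term → Bool
occT a (var y) = false
occT a (ct c)  = occC a c

occTs : ℕ → List Term → Bool
occTs a []       = false
occTs a (u ∷ us) = occT a u ∨ occTs a us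

occF : ℕ → Formula → Bool
occF a (pred n ts) = occTs a ts
occF a (E! u)      = occT a u
occF a (u ≐ v)     = occT a u ∨ occT a v
occF a ⊥'          = false
occF a (A ∧' B)    = occF a A ∨ occF a B
occF a (A ∨' B)    = occF a A ∨ occF a B
occF a (A ⇒ B)     = occF a A ∨ occF a B
occF a (A ⇔ B)     = occF a A ∨ occF a B
occF a (∀' y A)    = occF a A
occF a (∃' y A)    = occF a A
occF a (I y F G)   = occF a F ∨ occF a G

_∉F_ : ℕ → Formula → Set
a ∉F A = occF a A ≡ false

_∉Γ_ : ℕ → List Formula → Set
a ∉Γ Γ = All (a ∉F_) Γ

P : ℕ → Term
P a = ct (par a)

E!c : CTerm → Formula
E!c t = E! (ct t)

-- Derivability in IPF^I, presented as natural deduction in sequent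
-- style: Γ ⊢ A means A is deducible with open assumptions among Γ;
-- discharged assumptions are added to the context of the premiss.

infix 2 _⊢_

data _⊢_ (Γ : List Formula) : Formula → Set where
  ass  : ∀ {A} → A ∈ Γ → Γ ⊢ A
  ∧I   : ∀ {A B} → Γ ⊢ A → Γ ⊢ B → Γ ⊢ A ∧' B
  ∧E₁  : ∀ {A B} → Γ ⊢ A ∧' B → Γ ⊢ A
  ∧E₂  : ∀ {A B} → Γ ⊢ A ∧' B → Γ ⊢ B
  ⇒I   : ∀ {A B} → (A ∷ Γ) ⊢ B → Γ ⊢ A ⇒ B
  ⇒E   : ∀ {A B} → Γ ⊢ A ⇒ B → Γ ⊢ A → Γ ⊢ B
  ∨I₁  : ∀ {A B} → Γ ⊢ A → Γ ⊢ A ∨' B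
  ∨I₂  : ∀ {A B} → Γ ⊢ B → Γ ⊢ A ∨' B
  ∨E   : ∀ {A B C} → Γ ⊢ A ∨' B → (A ∷ Γ) ⊢ C → (B ∷ Γ) ⊢ C → Γ ⊢ C
  ⇔I   : ∀ {A B} → (A ∷ Γ) ⊢ B → (B ∷ Γ) ⊢ A → Γ ⊢ A ⇔ B
  ⇔E₁  : ∀ {A B} → Γ ⊢ A ⇔ B → Γ ⊢ A → Γ ⊢ B
  ⇔E₂  : ∀ {A B} → Γ ⊢ A ⇔ B → Γ ⊢ B → Γ ⊢ A
  ⊥E   : ∀ {A} → Atomic A → Γ ⊢ ⊥' → Γ ⊢ A
  ∀I   : ∀ {x A} a → a ∉F A → a ∉Γ Γ →
         (E!c (par a) ∷ Γ) ⊢ A [ x ≔ par a ] → Γ ⊢ ∀' x A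
  ∀E   : ∀ {x A} t → Γ ⊢ ∀' x A → Γ ⊢ E!c t → Γ ⊢ A [ x ≔ t ]
  ∃I   : ∀ {x A} t → Γ ⊢ A [ x ≔ t ] → Γ ⊢ E!c t → Γ ⊢ ∃' x A
  ∃E   : ∀ {x A C} a → a ∉F A → a ∉F C → a ∉Γ Γ →
         Γ ⊢ ∃' x A → (A [ x ≔ par a ] ∷ E!c (par a) ∷ Γ) ⊢ C → Γ ⊢ C
  =I   : ∀ t → Γ ⊢ ct t ≐ ct t
  =E   : ∀ {x A} t₁ t₂ → Atomic A →
         Γ ⊢ ct t₁ ≐ ct t₂ → Γ ⊢ A [ x ≔ t₁ ] → Γ ⊢ A [ x ≔ t₂ ]
  II   : ∀ {x F G} t a → a ∉F F → a ∉F G → a ∉Γ Γ → t ≢ par a →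
         Γ ⊢ F [ x ≔ t ] → Γ ⊢ G [ x ≔ t ] → Γ ⊢ E!c t →
         (F [ x ≔ par a ] ∷ E!c (par a) ∷ Γ) ⊢ P a ≐ ct t →
         Γ ⊢ I x F G
  IE1p : ∀ {x F G C} t a b →
         a ∉F F → a ∉F G → a ∉F C → a ∉Γ Γ → t ≢ par a →
         b ∉F F → b ∉F G → b ∉F C → b ∉Γ Γ →
         Γ ⊢ I x F G → Γ ⊢ F [ x ≔ t ] → Γ ⊢ E!c t →
         (F [ x ≔ par a ] ∷ E!c (par a) ∷ Γ) ⊢ P a ≐ ct t →
         (F [ x ≔ par b ] ∷ G [ x ≔ par b ] ∷ E!c (par b) ∷ Γ) ⊢ C →
         Γ ⊢ C
  IE2p : ∀ {x F A} t₁ t₂ → Atomic A →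
         Γ ⊢ I x F (E! (var x)) → Γ ⊢ E!c t₁ → Γ ⊢ E!c t₂ →
         Γ ⊢ F [ x ≔ t₁ ] → Γ ⊢ F [ x ≔ t₂ ] → Γ ⊢ A [ x ≔ t₁ ] →
         Γ ⊢ A [ x ≔ t₂ ]
  IE3p : ∀ {x F C} a → a ∉F F → a ∉F C → a ∉Γ Γ →
         Γ ⊢ I x F (E! (var x)) →
         (F [ x ≔ par a ] ∷ E!c (par a) ∷ Γ) ⊢ C → Γ ⊢ C
  IE4p : ∀ {x F A} t₁ t₂ → Atomic A →
         Γ ⊢ I x F (var x ≐ ct t₂) → Γ ⊢ E!c t₁ → Γ ⊢ E!c t₂ →
         Γ ⊢ F [ x ≔ t₁ ] → Γ ⊢ A [ x ≔ t₁ ] → Γ ⊢ A [ x ≔ t₂ ]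
  IE5p : ∀ {x F C} t a → a ∉F F → t ≢ par a → a ∉F C → a ∉Γ Γ →
         Γ ⊢ I x F (var x ≐ ct t) → Γ ⊢ E!c t →
         (F [ x ≔ par a ] ∷ E!c (par a) ∷ Γ) ⊢ C → Γ ⊢ C

{-# OPTIONS --safe #-}
-- Eliminate Ix[F, x = a] by IE5p with a fresh witness b of F, and reintroduce the
-- description as Ix[F, ∃!x] by II with b as its object: for any further fresh c with
-- F(c), IE4p turns F(b) and F(c) into a = b and a = c, whence c = b by =E.
-- Freshness is discharged uniformly by taking a parameter above all in the context.
module Submission where

open import Defs
open import Data.Nat using (ℕ; zero; suc; _⊔_; _<_; _≡ᵇ_; s≤s)
open import Data.Nat.Properties using (≡⇒≡ᵇ; m⊔n<o⇒m<o; m⊔n<o⇒n<o; n<1+n)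
open import Data.Bool using (T; false; _∨_)
open import Data.Bool.Properties using (T-≡)
open import Data.List using (List; []; _∷_; foldr)
open import Data.List.Relation.Unary.All using ([]; _∷_; head; tail)
open import Data.List.Relation.Unary.Any using (here; there)
open import Function.Bundles using (Equivalence)
open import Relation.Binary.PropositionalEquality
  using (_≡_; _≢_; refl; sym; cong; cong₂; subst)

open Equivalence using (to)

<⇒≡ᵇ-false : ∀ {m n} → m < n → (n ≡ᵇ m) ≡ false
<⇒≡ᵇ-false {zero}  {suc n} _         = refl
<⇒≡ᵇ-false {suc m} {suc n} (s≤s m<n) = <⇒≡ᵇ-false m<n

paramBoundT : Term → ℕ
paramBoundT (ct (par b)) = b
paramBoundT _            = 0

paramBoundTs : List Term → ℕ
paramBoundTs = foldr (λ u m → paramBoundT u ⊔ m) 0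

paramBound : Formula → ℕ
paramBound (pred n ts) = paramBoundTs ts
paramBound (E! u)      = paramBoundT u
paramBound (u ≐ v)     = paramBoundT u ⊔ paramBoundT v
paramBound ⊥'          = 0
paramBound (A ∧' B)    = paramBound A ⊔ paramBound B
paramBound (A ∨' B)    = paramBound A ⊔ paramBound B
paramBound (A ⇒ B)     = paramBound A ⊔ paramBound B
paramBound (A ⇔ B)     = paramBound A ⊔ paramBound B
paramBound (∀' y A)    = paramBound A
paramBound (∃' y A)    = paramBound A
paramBound (I y F G)   = paramBound F ⊔ paramBound G

contextBound : List Formula → ℕ
contextBound = foldr (λ A m → paramBound A ⊔ m) 0

⊔<⇒∨-false : ∀ {p q n} i j → (i < n → p ≡ false) → (j < n → q ≡ false) →
              i ⊔ j < n → p ∨ q ≡ false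
⊔<⇒∨-false i j p∉ q∉ lt = cong₂ _∨_ (p∉ (m⊔n<o⇒m<o i j lt)) (q∉ (m⊔n<o⇒n<o i j lt))

paramBoundT<⇒∉ : ∀ {n} u → paramBoundT u < n → occT n u ≡ false
paramBoundT<⇒∉ (var y)      _   = refl
paramBoundT<⇒∉ (ct (par b)) b<n = <⇒≡ᵇ-false b<n
paramBoundT<⇒∉ (ct (con c)) _   = refl

paramBoundTs<⇒∉ : ∀ {n} us → paramBoundTs us < n → occTs n us ≡ false
paramBoundTs<⇒∉ []       _ = refl
paramBoundTs<⇒∉ (u ∷ us)   =
  ⊔<⇒∨-false _ _ (paramBoundT<⇒∉ u) (paramBoundTs<⇒∉ us)

paramBound<⇒∉F : ∀ {n} A → paramBound A < n → n ∉F A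
paramBound<⇒∉F (pred m ts) = paramBoundTs<⇒∉ ts
paramBound<⇒∉F (E! u)      = paramBoundT<⇒∉ u
paramBound<⇒∉F (u ≐ v)     = ⊔<⇒∨-false _ _ (paramBoundT<⇒∉ u) (paramBoundT<⇒∉ v)
paramBound<⇒∉F ⊥'          = λ _ → refl
paramBound<⇒∉F (A ∧' B)    = ⊔<⇒∨-false _ _ (paramBound<⇒∉F A) (paramBound<⇒∉F B)
paramBound<⇒∉F (A ∨' B)    = ⊔<⇒∨-false _ _ (paramBound<⇒∉F A) (paramBound<⇒∉F B)
paramBound<⇒∉F (A ⇒ B)     = ⊔<⇒∨-false _ _ (paramBound<⇒∉F A) (paramBound<⇒∉F B)
paramBound<⇒∉F (A ⇔ B)     = ⊔<⇒∨-false _ _ (paramBound<⇒∉F A) (paramBound<⇒∉F B)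
paramBound<⇒∉F (∀' y A)    = paramBound<⇒∉F A
paramBound<⇒∉F (∃' y A)    = paramBound<⇒∉F A
paramBound<⇒∉F (I y F G)   = ⊔<⇒∨-false _ _ (paramBound<⇒∉F F) (paramBound<⇒∉F G)

contextBound<⇒∉Γ : ∀ {n} Γ → contextBound Γ < n → n ∉Γ Γ
contextBound<⇒∉Γ []      _  = []
contextBound<⇒∉Γ (A ∷ Γ) lt =
  paramBound<⇒∉F A (m⊔n<o⇒m<o (paramBound A) _ lt) ∷
  contextBound<⇒∉Γ Γ (m⊔n<o⇒n<o (paramBound A) _ lt)

freshParam : List Formula → ℕ
freshParam Γ = suc (contextBound Γ)

freshParam-∉Γ : ∀ Γ → freshParam Γ ∉Γ Γ
freshParam-∉Γ Γ = contextBound<⇒∉Γ Γ (n<1+n (contextBound Γ))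

∉F-E!c⇒≢par : ∀ {n} t → n ∉F E!c t → t ≢ par n
∉F-E!c⇒≢par {n} t n∉ refl = subst T n∉ (≡⇒≡ᵇ n n refl)

substT-var-self : ∀ x t → substT x t (var x) ≡ ct t
substT-var-self x t rewrite to T-≡ (≡⇒≡ᵇ x x refl) = refl

≐-subst-var : ∀ x t u → (var x ≐ ct u) [ x ≔ t ] ≡ (ct t ≐ ct u)
≐-subst-var x t u = cong (_≐ ct u) (substT-var-self x t)

E!c⇒E!-var-subst : ∀ {Γ} x t → Γ ⊢ E!c t → Γ ⊢ E! (var x) [ x ≔ t ]
E!c⇒E!-var-subst {Γ} x t = subst (Γ ⊢_) (cong E! (sym (substT-var-self x t)))

IE4p-≐ : ∀ {Γ x F} t u → Γ ⊢ I x F (var x ≐ ct u) → Γ ⊢ E!c t → Γ ⊢ E!c u →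
         Γ ⊢ F [ x ≔ t ] → Γ ⊢ ct u ≐ ct t
IE4p-≐ {Γ} {x} t u IF E!t E!u Ft =
  subst (Γ ⊢_) (≐-subst-var x u t)
    (IE4p {A = var x ≐ ct t} t u (at-≐ _ _) IF E!t E!u Ft
      (subst (Γ ⊢_) (sym (≐-subst-var x t t)) (=I t)))

≐-euclidean : ∀ {Γ} t u s → Γ ⊢ ct u ≐ ct t → Γ ⊢ ct u ≐ ct s → Γ ⊢ ct t ≐ ct s
≐-euclidean t u s = =E {x = 0} {A = var 0 ≐ ct s} u t (at-≐ _ _)

IE5p-fresh : ∀ {Γ x F C} t → Γ ⊢ I x F (var x ≐ ct t) → Γ ⊢ E!c t →
             (∀ b → (F [ x ≔ par b ] ∷ E!c (par b) ∷ Γ) ⊢ C) → Γ ⊢ C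
IE5p-fresh {Γ} {x} {F} {C} t IF E!t premiss = go (freshParam-∉Γ (F ∷ C ∷ E!c t ∷ Γ))
  where
  b : ℕ
  b = freshParam (F ∷ C ∷ E!c t ∷ Γ)
  go : b ∉Γ (F ∷ C ∷ E!c t ∷ Γ) → Γ ⊢ C
  go (b∉F ∷ b∉C ∷ b∉t ∷ b∉Γ) = IE5p t b b∉F (∉F-E!c⇒≢par t b∉t) b∉C b∉Γ IF E!t (premiss b)

II-fresh : ∀ {Γ x F G} t → Γ ⊢ F [ x ≔ t ] → Γ ⊢ G [ x ≔ t ] → Γ ⊢ E!c t →
           (∀ c → (F [ x ≔ par c ] ∷ E!c (par c) ∷ Γ) ⊢ P c ≐ ct t) → Γ ⊢ I x F G
II-fresh {Γ} {x} {F} {G} t Ft Gt E!t unique = go (freshParam-∉Γ (F ∷ G ∷ E!c t ∷ Γ))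
  where
  c : ℕ
  c = freshParam (F ∷ G ∷ E!c t ∷ Γ)
  go : c ∉Γ (F ∷ G ∷ E!c t ∷ Γ) → Γ ⊢ I x F G
  go (c∉F ∷ c∉G ∷ c∉t ∷ c∉Γ) = II t c c∉F c∉G c∉Γ (∉F-E!c⇒≢par t c∉t) Ft Gt E!t (unique c)

mainTheorem15 : (F : Formula) (x a : ℕ) → a ∉F F →
    (I x F (var x ≐ P a) ∷ E! (P a) ∷ []) ⊢ I x F (E! (var x))
mainTheorem15 F x a _ =
  IE5p-fresh (par a) (ass (here refl)) (ass (there (here refl))) λ b →
    II-fresh (par b) (ass (here refl))
      (E!c⇒E!-var-subst x (par b) (ass (there (here refl))))
      (ass (there (here refl)))
      λ c →
        let IF  = ass (there (there (there (there (here refl)))))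
            E!a = ass (there (there (there (there (there (here refl))))))
        in ≐-euclidean (par c) (par a) (par b)
             (IE4p-≐ (par c) (par a) IF (ass (there (here refl))) E!a (ass (here refl)))
             (IE4p-≐ (par b) (par a) IF (ass (there (there (there (here refl))))) E!a
                     (ass (there (there (here refl)))))
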